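{- Let $\lambda=(m,n)$ be a triangular $2$-partition and let $\theta$ be a row-regular tableau on $\lambda$. Then $$A_\theta(q,t)=\sum_{0\le d\le \min(n,\,m-n)} s_{(m+n-2d,\,d)}(q,t).$$
   Context: A partition $\lambda=(\lambda_1\ge\lambda_2\ge\cdots)$ is drawn in French convention: cell $(\ell,c)$ (row $\ell\ge0$ counted from the bottom, column $c\ge 0$) belongs to $\lambda$ iff $c<\lambda_{\ell+1}$. A $2$-partition $(m,n)$ has $m\ge n\ge 0$: a bottom row of $m$ cells and an upper row of $n$ cells. A partition $\lambda$ is triangular if there are positive reals $r,s$ with $\lambda_j=\lfloor r-jr/s\rfloor$ for integers $1\le j\le s$ and $\lambda_j=0$ for $j>s$. A subpartition $\mu\subseteq\lambda$ satisfies $\mu_i\le\lambda_i$ for all $i$; its area is $\mathrm{area}(\lambda,\mu)=|\lambda|-|\mu|$. A standard Young tableau $\theta$ of shape $\lambda$ is a bijection from the cells of $\lambda$ to $\{1,\dots,|\lambda|\}$ increasing to the right along rows and upwards along columns. Given a subpartition $\mu$, a cell $d$ is a $\theta$-deficit cell of $(\lambda,\mu)$ if there exist cells $c_1=(i_1,j_1)\in\mu$ and $c_2=(i_2,j_2)\in\lambda\setminus\mu$ with $\theta(c_1)>\theta(c_2)$ and $d=(\min(i_1,i_2),\min(j_1,j_2))$. Let $\mathrm{sim}_\theta(\mu)$ be the number of cells of $\mu$ which are not $\theta$-deficit cells, and $A_\theta(q,t)=\sum_{\mu\subseteq\lambda}q^{\mathrm{area}(\lambda,\mu)}t^{\mathrm{sim}_\theta(\mu)}$,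 summed over all subpartitions $\mu$ of $\lambda$. For a triangular $2$-partition $\lambda=(m,n)$ and an integer $i$ with $1\le i\le m-2(n-1)$, the $i$-row-regular tableau of $\lambda$ is the standard Young tableau whose upper row has labels $n+i,n+i+2,\dots,n+i+2(n-1)$ (the bottom row then contains the remaining labels in increasing order); a row-regular tableau is an $i$-row-regular tableau for some such $i$. For integers $b\ge a\ge0$, $s_{(b,a)}(q,t)=\sum_{k=a}^{b}q^k t^{a+b-k}$ is the Schur polynomial in two variables.
   Formalization: The positive numbers r, s witnessing that λ is triangular range only over the positive rationals rather than the positive reals. -}

module Defs where

open import Data.Nat using (ℕ; zero; suc; _+_; _*_; _∸_; _≤_; _<_; _⊓_; _≡ᵇ_; _<ᵇ_)
open import Data.Bool using (Bool; true; false; not; _∧_; _∨_)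
open import Data.List using (List; []; _∷_; _++_; map; concatMap; filterᵇ; length; upTo)
open import Data.Bool.ListAction using (any)
open import Data.Product using (_×_; _,_; proj₁; proj₂; Σ)
open import Data.Integer using (ℤ) renaming (+_ to ℤ+_)
open import Relation.Binary.PropositionalEquality using (_≡_)
import Data.Rational as ℚ
open ℚ using (ℚ; Positive; floor; _÷_)
open import Data.Rational.Properties using (pos⇒nonZero)

-- A 2-partition (m,n) (m ≥ n) is represented by the pair of its row lengths.
-- A cell (ℓ , c) : row ℓ (0 = bottom), column c.
Cell : Set
Cell = ℕ × ℕ

part : ℕ × ℕ → ℕ → ℕ
part (m , n) 1 = m
part (m , n) 2 = n
part (m , n) _ = 0

inShapeᵇ : ℕ × ℕ → Cell → Bool
inShapeᵇ μ (ℓ , c) = c <ᵇ part μ (suc ℓ)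

cells : ℕ × ℕ → List Cell
cells (a , b) = map (λ c → (0 , c)) (upTo a) ++ map (λ c → (1 , c)) (upTo b)

size : ℕ × ℕ → ℕ
size (a , b) = a + b

subpartitions : ℕ × ℕ → List (ℕ × ℕ)
subpartitions (m , n) =
  concatMap (λ a → map (λ b → (a , b)) (upTo (suc (a ⊓ n)))) (upTo (suc m))

area : ℕ × ℕ → ℕ × ℕ → ℕ
area λ' μ = size λ' ∸ size μ

Filling : Set
Filling = Cell → ℕ

_==ᶜ_ : Cell → Cell → Bool
(a , b) ==ᶜ (c , d) = (a ≡ᵇ c) ∧ (b ≡ᵇ d)

isDeficitᵇ : Filling → ℕ × ℕ → ℕ × ℕ → Cell → Bool
isDeficitᵇ θ λ' μ d =
  any (λ c₁ → any (λ c₂ →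
         (θ c₂ <ᵇ θ c₁) ∧ (d ==ᶜ (proj₁ c₁ ⊓ proj₁ c₂ , proj₂ c₁ ⊓ proj₂ c₂)))
       (filterᵇ (λ c → not (inShapeᵇ μ c)) (cells λ')))
      (cells μ)

sim : Filling → ℕ × ℕ → ℕ × ℕ → ℕ
sim θ λ' μ = length (filterᵇ (λ d → not (isDeficitᵇ θ λ' μ d)) (cells μ))

-- Polynomials in q, t with ℕ coefficients, as coefficient functions:
-- P x y = coefficient of q^x t^y.
Poly : Set
Poly = ℕ → ℕ → ℕ

0ₚ : Poly
0ₚ _ _ = 0

_+ₚ_ : Poly → Poly → Poly
(P +ₚ Q) x y = P x y + Q x y

mono : ℕ → ℕ → Poly
mono a b x y with (a ≡ᵇ x) ∧ (b ≡ᵇ y)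
... | true  = 1
... | false = 0

∑ : {A : Set} → List A → (A → Poly) → Poly
∑ []       f = 0ₚ
∑ (x ∷ xs) f = f x +ₚ ∑ xs f

Aθ : Filling → ℕ × ℕ → Poly
Aθ θ λ' = ∑ (subpartitions λ') (λ μ → mono (area λ' μ) (sim θ λ' μ))

range : ℕ → ℕ → List ℕ
range a b = map (λ k → a + k) (upTo (suc b ∸ a))

schur : ℕ → ℕ → Poly
schur b a = ∑ (range a b) (λ k → mono k (a + b ∸ k))

ℕ→ℚ : ℕ → ℚ
ℕ→ℚ j = (ℤ+ j) ℚ./ 1

triFloor : (r s : ℚ) → .{{Positive s}} → ℕ → ℤ
triFloor r s j = floor (r ℚ.- (ℕ→ℚ j ℚ.* r) ÷ s)
  where instance _ = pos⇒nonZero s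

Triangular : ℕ × ℕ → Set
Triangular λ' =
  Σ ℚ λ r → Σ ℚ λ s → Σ (Positive r) λ _ → Σ (Positive s) λ pos →
    ((j : ℕ) → 1 ≤ j → ℕ→ℚ j ℚ.≤ s → ℤ+ part λ' j ≡ triFloor r s {{pos}} j)
    × ((j : ℕ) → 1 ≤ j → s ℚ.< ℕ→ℚ j → part λ' j ≡ 0)

upperRow : ℕ → ℕ → List ℕ
upperRow n i = map (λ k → n + i + 2 * k) (upTo n)

bottomRow : ℕ → ℕ → ℕ → List ℕ
bottomRow m n i =
  filterᵇ (λ x → not (any (x ≡ᵇ_) (upperRow n i))) (map suc (upTo (m + n)))

-- k-th entry (0-indexed) of a list, 0 if out of range
nth : List ℕ → ℕ → ℕ
nth []       _       = 0
nth (x ∷ xs) zero    = x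
nth (x ∷ xs) (suc k) = nth xs k

rowRegular : ℕ → ℕ → ℕ → Filling
rowRegular m n i (0 , c)       = nth (bottomRow m n i) c
rowRegular m n i (1 , c)       = nth (upperRow n i) c
rowRegular m n i (suc (suc _) , _) = 0

-- Write i = 1 + i′ and P = n + i′. The upper row of the i-row-regular tableau carries the
-- labels P + 1 + 2k (k < n), so the bottom cell in column j carries j + 1 + κ (j + 1), where
-- κ a = min (n, a ∸ P) counts the upper labels below it. For μ = (a, b) no upper cell is a
-- deficit cell, and the bottom deficit cells are exactly the columns in
-- [min (b, κ (a + 1)), max (b, κ a)); hence sim μ = a + b − F (a, b) with
-- F (a, b) = max (b, κ a) − min (b, κ (a + 1)), while area μ = m + n − (a + b).
-- So it suffices that (a, b) ↦ (F (a, b), a + b) maps the subpartitions bijectively onto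
-- { (d, s) : d ≤ n, 2d ≤ s ≤ m + n − d }: for fixed d, the columns a < P give s ∈ [2d, P + d),
-- the columns P ≤ a < P + n give the even and odd offsets of s ∈ [P + d, P + 2n − d), and the
-- columns a ≥ P + n give s ∈ [P + 2n − d, m + n − d]. The d-th row is s_(m+n−2d, d), which is
-- zero for min (n, m − n) < d ≤ n.

module Submission where

open import Defs
open import Data.Nat using (ℕ; zero; suc; _+_; _*_; _∸_; _≤_; _<_; _⊓_; _⊔_; _≤ᵇ_; _<ᵇ_; _≡ᵇ_; _<?_; _≤?_; z≤n; s≤s; s≤s⁻¹; z<s)
open import Data.Nat.Properties
open import Data.Bool using (Bool; true; false; not; _∧_; if_then_else_; T)
open import Data.Unit using (tt)
open import Data.Empty using (⊥-elim)
open import Relation.Nullary using (¬_; yes; no)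
open import Function using (_∘_)
open import Relation.Binary.PropositionalEquality
open import Data.Nat.Tactic.RingSolver using (solve-∀)
open import Data.Product using (_×_; _,_; proj₁; proj₂; ∃)
open import Data.Sum using (inj₁; inj₂)
open import Data.List using (List; []; _∷_; _++_; map; concatMap; filterᵇ; length; upTo; applyUpTo)
open import Data.List.Properties using (map-upTo; filter-++; length-++)
open import Data.List.Membership.Propositional using (_∈_; find; lose)
open import Data.List.Membership.Propositional.Properties using (∈-map⁺; ∈-map⁻; ∈-++⁺ˡ; ∈-++⁺ʳ; ∈-++⁻; ∈-filter⁺; ∈-filter⁻; ∈-upTo⁺; ∈-upTo⁻)
open import Data.List.Relation.Unary.Any.Properties using (any⁺; any⁻)
open import Data.Bool.ListAction using (any)
open import Data.Bool.Properties using (T?; T-∧; T-≡)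
open import Function.Bundles using (_⇔_; mk⇔; Equivalence)
open ≡-Reasoning


<∸⇒+< : ∀ k {a P} → k < a ∸ P → k + P < a
<∸⇒+< k {a} {P} k<a∸P = m≤o∸n⇒m+n≤o (suc k) P≤a k<a∸P
  where
  P≤a : P ≤ a
  P≤a = <⇒≤ (∸-cancelʳ-< (≤-<-trans (≤-reflexive (n∸n≡0 a)) (≤-<-trans z≤n k<a∸P)))

<⊔⇒< : ∀ {c b k} → c < b ⊔ k → b ≤ c → c < k
<⊔⇒< {c} {b} {k} c< b≤c with ⊔-sel b k
... | inj₁ b⊔k≡b = ⊥-elim (<⇒≱ (<-≤-trans c< (≤-reflexive b⊔k≡b)) b≤c)
... | inj₂ b⊔k≡k = <-≤-trans c< (≤-reflexive b⊔k≡k)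

⊓≤⇒≤ : ∀ {c b k} → b ⊓ k ≤ c → c < b → k ≤ c
⊓≤⇒≤ {c} {b} {k} ≤c c<b with ⊓-sel b k
... | inj₁ b⊓k≡b = ⊥-elim (<⇒≱ c<b (≤-trans (≤-reflexive (sym b⊓k≡b)) ≤c))
... | inj₂ b⊓k≡k = ≤-trans (≤-reflexive (sym b⊓k≡k)) ≤c

n+n≤1+m⇒n≤m : ∀ {n m} → n + n ≤ suc m → n ≤ m
n+n≤1+m⇒n≤m {zero}  _  = z≤n
n+n≤1+m⇒n≤m {suc n} le = ≤-trans (m≤n+m (suc n) n) (s≤s⁻¹ le)

≮ᵇ⇒≥ : ∀ {j a} → ¬ T (j <ᵇ a) → a ≤ j
≮ᵇ⇒≥ j≮a = ≮⇒≥ (j≮a ∘ <⇒<ᵇ)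

if-true : ∀ {c} {x y : ℕ} → T c → (if c then x else y) ≡ x
if-true {true} _ = refl

if-false : ∀ {c} {x y : ℕ} → ¬ T c → (if c then x else y) ≡ y
if-false {false} _ = refl
if-false {true}  f = ⊥-elim (f tt)

T-injective : ∀ {x y} → (T x → T y) → (T y → T x) → x ≡ y
T-injective {false} {false} _ _ = refl
T-injective {false} {true}  _ g = ⊥-elim (g tt)
T-injective {true}  {false} f _ = ⊥-elim (f tt)
T-injective {true}  {true}  _ _ = refl

T-not : ∀ {x} → T (not x) → ¬ T x
T-not {false} _ ()

¬T-not : ∀ {x} → ¬ T x → T (not x)
¬T-not {false} _ = tt
¬T-not {true}  f = f tt


-- Finite sums over initial segments of ℕ

sumTo : ℕ → (ℕ → ℕ) → ℕ
sumTo zero    h = 0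
sumTo (suc N) h = h 0 + sumTo N (h ∘ suc)

sumTo-cong : ∀ N {h h′ : ℕ → ℕ} → (∀ k → k < N → h k ≡ h′ k) → sumTo N h ≡ sumTo N h′
sumTo-cong zero    eq = refl
sumTo-cong (suc N) eq = cong₂ _+_ (eq 0 z<s) (sumTo-cong N (λ k k<N → eq (suc k) (s≤s k<N)))

sumTo-zeros : ∀ N {h : ℕ → ℕ} → (∀ k → k < N → h k ≡ 0) → sumTo N h ≡ 0
sumTo-zeros zero    eq = refl
sumTo-zeros (suc N) eq = cong₂ _+_ (eq 0 z<s) (sumTo-zeros N (λ k k<N → eq (suc k) (s≤s k<N)))

sumTo-+ : ∀ N (h h′ : ℕ → ℕ) → sumTo N (λ k → h k + h′ k) ≡ sumTo N h + sumTo N h′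
sumTo-+ zero    h h′ = refl
sumTo-+ (suc N) h h′ = begin
  h 0 + h′ 0 + sumTo N (λ k → h (suc k) + h′ (suc k))  ≡⟨ cong (h 0 + h′ 0 +_) (sumTo-+ N _ _) ⟩
  h 0 + h′ 0 + (sumTo N (h ∘ suc) + sumTo N (h′ ∘ suc)) ≡⟨ +-medial (h 0) (h′ 0) _ _ ⟩
  sumTo (suc N) h + sumTo (suc N) h′                     ∎
  where
  +-medial : ∀ a b c d → a + b + (c + d) ≡ a + c + (b + d)
  +-medial = solve-∀

sumTo-+₄ : ∀ N (f g h k : ℕ → ℕ) →
  sumTo N (λ i → f i + g i + h i + k i) ≡ sumTo N f + sumTo N g + sumTo N h + sumTo N k
sumTo-+₄ N f g h k =
  trans (sumTo-+ N _ k) (cong (_+ sumTo N k) (trans (sumTo-+ N _ h) (cong (_+ sumTo N h) (sumTo-+ N f g))))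

sumTo-split : ∀ A B (h : ℕ → ℕ) → sumTo (A + B) h ≡ sumTo A h + sumTo B (λ k → h (A + k))
sumTo-split zero    B h = refl
sumTo-split (suc A) B h = trans (cong (h 0 +_) (sumTo-split A B (h ∘ suc))) (sym (+-assoc (h 0) _ _))

sumTo-split-at : ∀ {L} M (h : ℕ → ℕ) → M ≤ L → sumTo L h ≡ sumTo M h + sumTo (L ∸ M) (λ k → h (M + k))
sumTo-split-at {L} M h M≤L = trans (cong (λ z → sumTo z h) (sym (m+[n∸m]≡n M≤L))) (sumTo-split M (L ∸ M) h)

sumTo-snoc : ∀ N (h : ℕ → ℕ) → sumTo (suc N) h ≡ sumTo N h + h N
sumTo-snoc zero    h = +-comm (h 0) 0
sumTo-snoc (suc N) h = trans (cong (h 0 +_) (sumTo-snoc N (h ∘ suc))) (sym (+-assoc (h 0) _ _))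

sumTo-pad : ∀ {L M} (h : ℕ → ℕ) → L ≤ M → (∀ k → L ≤ k → k < M → h k ≡ 0) → sumTo L h ≡ sumTo M h
sumTo-pad {L} {M} h L≤M tail = begin
  sumTo L h                                     ≡⟨ +-identityʳ _ ⟨
  sumTo L h + 0                                 ≡⟨ cong (sumTo L h +_) (sumTo-zeros (M ∸ L) (λ k k< → tail (L + k) (m≤m+n L k) (L+k<M k<))) ⟨
  sumTo L h + sumTo (M ∸ L) (λ k → h (L + k))   ≡⟨ sumTo-split L (M ∸ L) h ⟨
  sumTo (L + (M ∸ L)) h                         ≡⟨ cong (λ z → sumTo z h) (m+[n∸m]≡n L≤M) ⟩
  sumTo M h                                     ∎
  where
  L+k<M : ∀ {k} → k < M ∸ L → L + k < M
  L+k<M k< = <-≤-trans (+-monoʳ-< L k<) (≤-reflexive (m+[n∸m]≡n L≤M))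

sumTo-reverse : ∀ N (h : ℕ → ℕ) → sumTo N h ≡ sumTo N (λ k → h (N ∸ suc k))
sumTo-reverse zero    h = refl
sumTo-reverse (suc N) h = begin
  h 0 + sumTo N (h ∘ suc)                          ≡⟨ cong (h 0 +_) (sumTo-reverse N (h ∘ suc)) ⟩
  h 0 + sumTo N (λ k → h (suc (N ∸ suc k)))        ≡⟨ +-comm (h 0) _ ⟩
  sumTo N (λ k → h (suc (N ∸ suc k))) + h 0        ≡⟨ cong₂ _+_ (sumTo-cong N (λ k k<N → cong h (+-∸-assoc 1 k<N)))
                                                               (cong h (n∸n≡0 N)) ⟨
  sumTo N (λ k → h (N ∸ k)) + h (N ∸ N)            ≡⟨ sumTo-snoc N (λ k → h (N ∸ k)) ⟨
  sumTo (suc N) (λ k → h (N ∸ k))                  ∎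

sumTo-interleave : ∀ M (h : ℕ → ℕ) → sumTo (M + M) h ≡ sumTo M (λ j → h (j + j) + h (suc (j + j)))
sumTo-interleave zero    h = refl
sumTo-interleave (suc M) h = begin
  h 0 + sumTo (M + suc M) (h ∘ suc)                       ≡⟨ cong (λ z → h 0 + sumTo z (h ∘ suc)) (+-suc M M) ⟩
  h 0 + (h 1 + sumTo (M + M) (h ∘ suc ∘ suc))             ≡⟨ +-assoc (h 0) _ _ ⟨
  h 0 + h 1 + sumTo (M + M) (h ∘ suc ∘ suc)               ≡⟨ cong (h 0 + h 1 +_) (sumTo-interleave M (h ∘ suc ∘ suc)) ⟩
  h 0 + h 1 + sumTo M (λ j → h (2 + (j + j)) + h (3 + (j + j)))
    ≡⟨ cong (h 0 + h 1 +_) (sumTo-cong M (λ j _ → cong₂ (λ u v → h u + h v) (cong suc (+-suc j j)) (cong (suc ∘ suc) (+-suc j j)))) ⟨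
  sumTo (suc M) (λ j → h (j + j) + h (suc (j + j)))       ∎

sumTo-triangle : ∀ N (F : ℕ → ℕ → ℕ) →
  sumTo N (λ a → sumTo (suc a) (F a)) ≡ sumTo N (λ b → sumTo (N ∸ b) (λ k → F (b + k) b))
sumTo-triangle zero    F = refl
sumTo-triangle (suc N) F = begin
  sumTo (suc N) (λ a → sumTo (suc a) (F a))
    ≡⟨ sumTo-snoc N _ ⟩
  sumTo N (λ a → sumTo (suc a) (F a)) + sumTo (suc N) (F N)
    ≡⟨ cong (_+ sumTo (suc N) (F N)) (sumTo-triangle N F) ⟩
  sumTo N column + sumTo (suc N) (F N)
    ≡⟨ cong (_+ sumTo (suc N) (F N)) (trans (cong (sumTo N column +_) (cong (λ z → sumTo z (λ k → F (N + k) N)) (n∸n≡0 N)))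
                                            (+-identityʳ _)) ⟨
  (sumTo N column + column N) + sumTo (suc N) (F N)
    ≡⟨ cong (_+ sumTo (suc N) (F N)) (sumTo-snoc N column) ⟨
  sumTo (suc N) column + sumTo (suc N) (F N)
    ≡⟨ sumTo-+ (suc N) column (F N) ⟨
  sumTo (suc N) (λ b → column b + F N b)
    ≡⟨ sumTo-cong (suc N) grow ⟩
  sumTo (suc N) (λ b → sumTo (suc N ∸ b) (λ k → F (b + k) b))
    ∎
  where
  column : ℕ → ℕ
  column b = sumTo (N ∸ b) (λ k → F (b + k) b)
  grow : ∀ b → b < suc N → column b + F N b ≡ sumTo (suc N ∸ b) (λ k → F (b + k) b)
  grow b (s≤s b≤N) = begin
    column b + F N b                         ≡⟨ cong (λ z → column b + F z b) (m+[n∸m]≡n b≤N) ⟨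
    column b + F (b + (N ∸ b)) b             ≡⟨ sumTo-snoc (N ∸ b) (λ k → F (b + k) b) ⟨
    sumTo (suc (N ∸ b)) (λ k → F (b + k) b)  ≡⟨ cong (λ z → sumTo z (λ k → F (b + k) b)) (+-∸-assoc 1 b≤N) ⟨
    sumTo (suc N ∸ b) (λ k → F (b + k) b)    ∎

sumTo-strict-triangle : ∀ n (G : ℕ → ℕ → ℕ) →
  sumTo (suc n) (λ b → sumTo b (G b)) ≡ sumTo (suc n) (λ d → sumTo (n ∸ d) (λ j → G (suc (d + j)) d))
sumTo-strict-triangle n G = begin
  sumTo n (λ a → sumTo (suc a) (G (suc a)))
    ≡⟨ sumTo-triangle n (G ∘ suc) ⟩
  sumTo n (λ d → sumTo (n ∸ d) (λ j → G (suc (d + j)) d))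
    ≡⟨ sumTo-pad _ (n≤1+n n) (λ d n≤d _ → cong (λ z → sumTo z (λ j → G (suc (d + j)) d)) (m≤n⇒m∸n≡0 n≤d)) ⟩
  sumTo (suc n) (λ d → sumTo (n ∸ d) (λ j → G (suc (d + j)) d))
    ∎

sumTo-triangle-⊓ : ∀ {n m} (E : ℕ → ℕ → ℕ) → n ≤ m →
  sumTo (suc m) (λ a → sumTo (suc (a ⊓ n)) (E a)) ≡ sumTo (suc n) (λ b → sumTo (suc m ∸ b) (λ k → E (b + k) b))
sumTo-triangle-⊓ {n} {m} E n≤m = begin
  sumTo (suc m) (λ a → sumTo (suc (a ⊓ n)) (E a))
    ≡⟨ sumTo-cong (suc m) (λ a _ → trans (sumTo-cong _ (λ b b≤a⊓n → sym (E≤-within a (≤-trans (s≤s⁻¹ b≤a⊓n) (m⊓n≤n a n)))))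
                                         (sumTo-pad (E≤ a) (s≤s (m⊓n≤m a n))
                                                    (λ b a⊓n<b b≤a → E≤-beyond a (beyond a⊓n<b (s≤s⁻¹ b≤a))))) ⟩
  sumTo (suc m) (λ a → sumTo (suc a) (E≤ a))
    ≡⟨ sumTo-triangle (suc m) E≤ ⟩
  sumTo (suc m) (λ b → sumTo (suc m ∸ b) (λ k → E≤ (b + k) b))
    ≡⟨ sumTo-pad (λ b → sumTo (suc m ∸ b) (λ k → E≤ (b + k) b)) (s≤s n≤m)
                 (λ b n<b _ → sumTo-zeros (suc m ∸ b) (λ k _ → E≤-beyond (b + k) n<b)) ⟨
  sumTo (suc n) (λ b → sumTo (suc m ∸ b) (λ k → E≤ (b + k) b))
    ≡⟨ sumTo-cong (suc n) (λ b b≤n → sumTo-cong (suc m ∸ b) (λ k _ → E≤-within (b + k) (s≤s⁻¹ b≤n))) ⟩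
  sumTo (suc n) (λ b → sumTo (suc m ∸ b) (λ k → E (b + k) b))
    ∎
  where
  E≤ : ℕ → ℕ → ℕ
  E≤ a b = if b ≤ᵇ n then E a b else 0
  E≤-within : ∀ a {b} → b ≤ n → E≤ a b ≡ E a b
  E≤-within _ b≤n = if-true (≤⇒≤ᵇ b≤n)
  E≤-beyond : ∀ a {b} → n < b → E≤ a b ≡ 0
  E≤-beyond _ {b} n<b = if-false (λ t → <⇒≱ n<b (≤ᵇ⇒≤ b n t))
  beyond : ∀ {a b} → a ⊓ n < b → b ≤ a → n < b
  beyond {a} {b} a⊓n<b b≤a with n <? b
  ... | yes n<b = n<b
  ... | no  n≮b = ⊥-elim (<⇒≱ a⊓n<b (⊓-glb b≤a (≮⇒≥ n≮b)))

sumTo-simplex-swap : ∀ N (G : ℕ → ℕ → ℕ) →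
  sumTo N (λ b → sumTo (N ∸ suc b) (G b)) ≡ sumTo N (λ d → sumTo (N ∸ suc d) (λ j → G j d))
sumTo-simplex-swap zero    G = refl
sumTo-simplex-swap (suc N) G = begin
  sumTo N (G 0) + sumTo N (λ b → sumTo (N ∸ suc b) (G (suc b)))
    ≡⟨ cong (sumTo N (G 0) +_) (sumTo-simplex-swap N (G ∘ suc)) ⟩
  sumTo N (G 0) + sumTo N (λ d → sumTo (N ∸ suc d) (λ j → G (suc j) d))
    ≡⟨ sumTo-+ N (G 0) _ ⟨
  sumTo N (λ d → sumTo (suc (N ∸ suc d)) (λ j → G j d))
    ≡⟨ sumTo-cong N (λ d d<N → cong (λ z → sumTo z (λ j → G j d)) (+-∸-assoc 1 d<N)) ⟨
  sumTo N (λ d → sumTo (N ∸ d) (λ j → G j d))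
    ≡⟨ sumTo-pad _ (n≤1+n N) (λ d N≤d _ → cong (λ z → sumTo z (λ j → G j d)) (m≤n⇒m∸n≡0 N≤d)) ⟩
  sumTo (suc N) (λ d → sumTo (N ∸ d) (λ j → G j d))
    ∎

count : ℕ → (ℕ → Bool) → ℕ
count N p = sumTo N (λ k → if p k then 1 else 0)

length-filterᵇ-applyUpTo : ∀ {A : Set} (p : A → Bool) (g : ℕ → A) N →
  length (filterᵇ p (applyUpTo g N)) ≡ count N (p ∘ g)
length-filterᵇ-applyUpTo p g zero = refl
length-filterᵇ-applyUpTo p g (suc N) with p (g 0)
... | true  = cong suc (length-filterᵇ-applyUpTo p (g ∘ suc) N)
... | false = length-filterᵇ-applyUpTo p (g ∘ suc) N

count-not : ∀ N (p : ℕ → Bool) → count N (not ∘ p) + count N p ≡ N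
count-not zero    p = refl
count-not (suc N) p with p 0
... | true  = trans (+-suc _ _) (cong suc (count-not N (p ∘ suc)))
... | false = cong suc (count-not N (p ∘ suc))

count-complement : ∀ N (p : ℕ → Bool) → count N (not ∘ p) ≡ N ∸ count N p
count-complement N p = trans (sym (m+n∸n≡m _ (count N p))) (cong (_∸ count N p) (count-not N p))

count-all : ∀ N (p : ℕ → Bool) → (∀ k → k < N → T (p k)) → count N p ≡ N
count-all zero    p _   = refl
count-all (suc N) p all = cong₂ _+_ (if-true (all 0 z<s)) (count-all N (p ∘ suc) (λ k k<N → all (suc k) (s≤s k<N)))

count-interval : ∀ lo hi N → count N (λ c → (lo ≤ᵇ c) ∧ (c <ᵇ hi)) ≡ hi ⊓ N ∸ lo
count-interval lo hi zero = trans (sym (0∸n≡0 lo)) (cong (_∸ lo) (sym (⊓-zeroʳ hi)))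
count-interval lo hi (suc N) = begin
  count (suc N) inside                          ≡⟨ sumTo-snoc N _ ⟩
  count N inside + (if inside N then 1 else 0)  ≡⟨ cong (_+ (if inside N then 1 else 0)) (count-interval lo hi N) ⟩
  hi ⊓ N ∸ lo + (if inside N then 1 else 0)     ≡⟨ step ⟩
  hi ⊓ suc N ∸ lo                               ∎
  where
  inside : ℕ → Bool
  inside c = (lo ≤ᵇ c) ∧ (c <ᵇ hi)
  step : hi ⊓ N ∸ lo + (if inside N then 1 else 0) ≡ hi ⊓ suc N ∸ lo
  step with N <? hi | lo ≤? N
  ... | no N≮hi | _ = begin
    hi ⊓ N ∸ lo + (if inside N then 1 else 0)
      ≡⟨ cong (hi ⊓ N ∸ lo +_) (if-false {inside N} (N≮hi ∘ <ᵇ⇒< N hi ∘ proj₂ ∘ Equivalence.to T-∧)) ⟩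
    hi ⊓ N ∸ lo + 0                           ≡⟨ +-identityʳ _ ⟩
    hi ⊓ N ∸ lo                               ≡⟨ cong (_∸ lo) (trans (m≤n⇒m⊓n≡m hi≤N) (sym (m≤n⇒m⊓n≡m (m≤n⇒m≤1+n hi≤N)))) ⟩
    hi ⊓ suc N ∸ lo                           ∎
    where hi≤N = ≮⇒≥ N≮hi
  ... | yes N<hi | yes lo≤N = begin
    hi ⊓ N ∸ lo + (if inside N then 1 else 0)
      ≡⟨ cong₂ (λ u v → u ∸ lo + v) (m≥n⇒m⊓n≡n (<⇒≤ N<hi)) (if-true {inside N} (Equivalence.from T-∧ (≤⇒≤ᵇ lo≤N , <⇒<ᵇ N<hi))) ⟩
    N ∸ lo + 1                                ≡⟨ +-comm (N ∸ lo) 1 ⟩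
    suc (N ∸ lo)                              ≡⟨ +-∸-assoc 1 lo≤N ⟨
    suc N ∸ lo                                ≡⟨ cong (_∸ lo) (m≥n⇒m⊓n≡n N<hi) ⟨
    hi ⊓ suc N ∸ lo                           ∎
  ... | yes N<hi | no lo≰N = begin
    hi ⊓ N ∸ lo + (if inside N then 1 else 0)
      ≡⟨ cong₂ (λ u v → u ∸ lo + v) (m≥n⇒m⊓n≡n (<⇒≤ N<hi)) (if-false {inside N} (lo≰N ∘ ≤ᵇ⇒≤ lo N ∘ proj₁ ∘ Equivalence.to T-∧)) ⟩
    N ∸ lo + 0                                ≡⟨ cong (_+ 0) (m≤n⇒m∸n≡0 (<⇒≤ lo>N)) ⟩
    0                                         ≡⟨ m≤n⇒m∸n≡0 lo>N ⟨
    suc N ∸ lo                                ≡⟨ cong (_∸ lo) (m≥n⇒m⊓n≡n N<hi) ⟨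
    hi ⊓ suc N ∸ lo                           ∎
    where lo>N = ≰⇒> lo≰N


-- Sums of monomials and Schur polynomials

∑-++ : ∀ {A : Set} (xs ys : List A) (f : A → Poly) x y → ∑ (xs ++ ys) f x y ≡ ∑ xs f x y + ∑ ys f x y
∑-++ []       ys f x y = refl
∑-++ (z ∷ xs) ys f x y = trans (cong (f z x y +_) (∑-++ xs ys f x y)) (sym (+-assoc (f z x y) _ _))

∑-concatMap : ∀ {A B : Set} (G : A → List B) (xs : List A) (f : B → Poly) x y →
  ∑ (concatMap G xs) f x y ≡ ∑ xs (λ a → ∑ (G a) f) x y
∑-concatMap G []       f x y = refl
∑-concatMap G (a ∷ xs) f x y = trans (∑-++ (G a) (concatMap G xs) f x y) (cong (∑ (G a) f x y +_) (∑-concatMap G xs f x y))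

∑-applyUpTo : ∀ {A : Set} (g : ℕ → A) N (f : A → Poly) x y → ∑ (applyUpTo g N) f x y ≡ sumTo N (λ k → f (g k) x y)
∑-applyUpTo g zero    f x y = refl
∑-applyUpTo g (suc N) f x y = cong (f (g 0) x y +_) (∑-applyUpTo (g ∘ suc) N f x y)

∑-map-upTo : ∀ {A : Set} (g : ℕ → A) N (f : A → Poly) x y → ∑ (map g (upTo N)) f x y ≡ sumTo N (λ k → f (g k) x y)
∑-map-upTo g N f x y = trans (cong (λ xs → ∑ xs f x y) (map-upTo g N)) (∑-applyUpTo g N f x y)

Aθ-as-double-sum : ∀ θ m n x y → Aθ θ (m , n) x y
  ≡ sumTo (suc m) (λ a → sumTo (suc (a ⊓ n)) (λ b → mono (area (m , n) (a , b)) (sim θ (m , n) (a , b)) x y))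
Aθ-as-double-sum θ m n x y = begin
  ∑ (concatMap row (upTo (suc m))) term x y        ≡⟨ ∑-concatMap row (upTo (suc m)) term x y ⟩
  ∑ (upTo (suc m)) (λ a → ∑ (row a) term) x y      ≡⟨ ∑-applyUpTo (λ a → a) (suc m) (λ a → ∑ (row a) term) x y ⟩
  sumTo (suc m) (λ a → ∑ (row a) term x y)         ≡⟨ sumTo-cong (suc m) (λ a _ → ∑-map-upTo (a ,_) (suc (a ⊓ n)) term x y) ⟩
  sumTo (suc m) (λ a → sumTo (suc (a ⊓ n)) (λ b → term (a , b) x y)) ∎
  where
  row : ℕ → List (ℕ × ℕ)
  row a = map (a ,_) (upTo (suc (a ⊓ n)))
  term : ℕ × ℕ → Poly
  term μ = mono (area (m , n) μ) (sim θ (m , n) μ)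

schur-as-sum : ∀ b a x y → schur b a x y ≡ sumTo (suc b ∸ a) (λ k → mono (a + k) (a + b ∸ (a + k)) x y)
schur-as-sum b a x y = ∑-map-upTo (a +_) (suc b ∸ a) (λ k → mono k (a + b ∸ k)) x y

schur-vanishes : ∀ {b a} → b < a → ∀ x y → schur b a x y ≡ 0
schur-vanishes {b} {a} b<a x y =
  trans (schur-as-sum b a x y) (cong (λ z → sumTo z (λ k → mono (a + k) (a + b ∸ (a + k)) x y)) (m≤n⇒m∸n≡0 b<a))

schur-reversed : ∀ b a x y → schur b a x y ≡ sumTo (suc b ∸ a) (λ k → mono (b ∸ k) (a + k) x y)
schur-reversed b a x y = begin
  schur b a x y
    ≡⟨ schur-as-sum b a x y ⟩
  sumTo L (λ k → mono (a + k) (a + b ∸ (a + k)) x y)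
    ≡⟨ sumTo-reverse L _ ⟩
  sumTo L (λ k → mono (a + (L ∸ suc k)) (a + b ∸ (a + (L ∸ suc k))) x y)
    ≡⟨ sumTo-cong L (λ k k<L → cong (λ j → mono j (a + b ∸ j) x y) (mirror k<L)) ⟩
  sumTo L (λ k → mono (b ∸ k) (a + b ∸ (b ∸ k)) x y)
    ≡⟨ sumTo-cong L (λ k k<L → cong (λ i → mono (b ∸ k) i x y) (complement k<L)) ⟩
  sumTo L (λ k → mono (b ∸ k) (a + k) x y)
    ∎
  where
  L : ℕ
  L = suc b ∸ a
  k+a≤b : ∀ {k} → k < L → k + a ≤ b
  k+a≤b k<L = s≤s⁻¹ (<∸⇒+< _ k<L)
  mirror : ∀ {k} → k < L → a + (L ∸ suc k) ≡ b ∸ k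
  mirror {k} k<L = begin
    a + (suc b ∸ a ∸ suc k)  ≡⟨ cong (a +_) (trans (∸-+-assoc (suc b) a (suc k)) (cong (suc b ∸_) (+-suc a k))) ⟩
    a + (b ∸ (a + k))        ≡⟨ cong (λ z → a + (b ∸ z)) (+-comm a k) ⟩
    a + (b ∸ (k + a))        ≡⟨ cong (a +_) (∸-+-assoc b k a) ⟨
    a + (b ∸ k ∸ a)          ≡⟨ m+[n∸m]≡n (m+n≤o⇒m≤o∸n a (≤-trans (≤-reflexive (+-comm a k)) (k+a≤b k<L))) ⟩
    b ∸ k                    ∎
  complement : ∀ {k} → k < L → a + b ∸ (b ∸ k) ≡ a + k
  complement {k} k<L = trans (+-∸-assoc a (m∸n≤m b k)) (cong (a +_) (m∸[m∸n]≡n (≤-trans (m≤m+n k a) (k+a≤b k<L))))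

schur-as-deficit-row : ∀ N d x y →
  sumTo (suc (N ∸ 2 * d) ∸ d) (λ k → mono (N ∸ (d + k + d)) (d + k + d ∸ d) x y) ≡ schur (N ∸ 2 * d) d x y
schur-as-deficit-row N d x y = begin
  sumTo (suc (N ∸ 2 * d) ∸ d) (λ k → mono (N ∸ (d + k + d)) (d + k + d ∸ d) x y)
    ≡⟨ sumTo-cong (suc (N ∸ 2 * d) ∸ d) (λ k _ → cong₂ (λ u v → mono u v x y) (exponent-q k) (m+n∸n≡m (d + k) d)) ⟩
  sumTo (suc (N ∸ 2 * d) ∸ d) (λ k → mono (N ∸ 2 * d ∸ k) (d + k) x y)
    ≡⟨ schur-reversed (N ∸ 2 * d) d x y ⟨
  schur (N ∸ 2 * d) d x y
    ∎
  where
  exponent-q : ∀ k → N ∸ (d + k + d) ≡ N ∸ 2 * d ∸ k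
  exponent-q k = trans (cong (N ∸_) (rearrange d k)) (sym (∸-+-assoc N (2 * d) k))
    where
    rearrange : ∀ d k → d + k + d ≡ 2 * d + k
    rearrange = solve-∀

cutoff<d⇒m+n∸2d<d : ∀ {m n d} → n + n ≤ suc m → n ⊓ (m ∸ n) < d → d ≤ n → m + n ∸ 2 * d < d
cutoff<d⇒m+n∸2d<d {m} {n} {d} 2n≤1+m cut<d d≤n = subst (λ d → m + n ∸ 2 * d < d) (sym d≡n) m+n∸2n<n
  where
  n≤m : n ≤ m
  n≤m = n+n≤1+m⇒n≤m {n} 2n≤1+m
  m∸n<d : m ∸ n < d
  m∸n<d with ⊓-sel n (m ∸ n)
  ... | inj₁ cut≡n   = ⊥-elim (<⇒≱ (subst (_< d) cut≡n cut<d) d≤n)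
  ... | inj₂ cut≡m∸n = subst (_< d) cut≡m∸n cut<d
  1+m≤n+d : suc m ≤ n + d
  1+m≤n+d = ≤-trans (≤-reflexive (trans (cong suc (sym (m+[n∸m]≡n n≤m))) (sym (+-suc n (m ∸ n))))) (+-monoʳ-≤ n m∸n<d)
  d≡n : d ≡ n
  d≡n = ≤-antisym d≤n (+-cancelˡ-≤ n n d (≤-trans 2n≤1+m 1+m≤n+d))
  m+n∸2n<n : m + n ∸ 2 * n < n
  m+n∸2n<n = subst (_< n) (sym m+n∸2n≡m∸n) (subst (m ∸ n <_) d≡n m∸n<d)
    where
    m+n∸2n≡m∸n : m + n ∸ 2 * n ≡ m ∸ n
    m+n∸2n≡m∸n = begin
      m + n ∸ 2 * n      ≡⟨ cong (m + n ∸_) (double n) ⟩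
      m + n ∸ (n + n)    ≡⟨ ∸-+-assoc (m + n) n n ⟨
      m + n ∸ n ∸ n      ≡⟨ cong (_∸ n) (m+n∸n≡m m n) ⟩
      m ∸ n              ∎
      where
      double : ∀ n → 2 * n ≡ n + n
      double = solve-∀


-- Deficit cells

==ᶜ⇒≡ : ∀ c d → T (c ==ᶜ d) → c ≡ d
==ᶜ⇒≡ (i , j) (k , l) t with Equivalence.to T-∧ t
... | i≡k , j≡l = cong₂ _,_ (≡ᵇ⇒≡ i k i≡k) (≡ᵇ⇒≡ j l j≡l)

≡⇒==ᶜ : ∀ c → T (c ==ᶜ c)
≡⇒==ᶜ (i , j) = Equivalence.from T-∧ (≡⇒≡ᵇ i i refl , ≡⇒≡ᵇ j j refl)

∈-cells⇔ : ∀ {μ c} → c ∈ cells μ ⇔ T (inShapeᵇ μ c)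
∈-cells⇔ {a , b} {c} = mk⇔ to from
  where
  to : ∀ {c} → c ∈ cells (a , b) → T (inShapeᵇ (a , b) c)
  to c∈ with ∈-++⁻ (map (0 ,_) (upTo a)) c∈
  ... | inj₁ c∈₀ with _ , j∈ , refl ← ∈-map⁻ (0 ,_) c∈₀ = <⇒<ᵇ (∈-upTo⁻ j∈)
  ... | inj₂ c∈₁ with _ , j∈ , refl ← ∈-map⁻ (1 ,_) c∈₁ = <⇒<ᵇ (∈-upTo⁻ j∈)
  from : ∀ {c} → T (inShapeᵇ (a , b) c) → c ∈ cells (a , b)
  from {0 , j}           t = ∈-++⁺ˡ (∈-map⁺ (0 ,_) (∈-upTo⁺ (<ᵇ⇒< j a t)))
  from {1 , j}           t = ∈-++⁺ʳ (map (0 ,_) (upTo a)) (∈-map⁺ (1 ,_) (∈-upTo⁺ (<ᵇ⇒< j b t)))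
  from {suc (suc _) , j} t = ⊥-elim (n≮0 (<ᵇ⇒< j 0 t))

meet : Cell → Cell → Cell
meet (i₁ , j₁) (i₂ , j₂) = (i₁ ⊓ i₂ , j₁ ⊓ j₂)

record DeficitWitness (θ : Filling) (λ′ μ : ℕ × ℕ) (d : Cell) : Set where
  constructor witness
  field
    inner outer : Cell
    inner∈μ     : T (inShapeᵇ μ inner)
    outer∈λ     : T (inShapeᵇ λ′ outer)
    outer∉μ     : ¬ T (inShapeᵇ μ outer)
    inverted    : θ outer < θ inner
    at-meet     : d ≡ meet inner outer

isDeficitᵇ⇔ : ∀ {θ λ′ μ d} → T (isDeficitᵇ θ λ′ μ d) ⇔ DeficitWitness θ λ′ μ d
isDeficitᵇ⇔ {θ} {λ′} {μ} {d} = mk⇔ to from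
  where
  outside : List Cell
  outside = filterᵇ (λ c → not (inShapeᵇ μ c)) (cells λ′)
  witnesses : Cell → Cell → Bool
  witnesses c₁ c₂ = (θ c₂ <ᵇ θ c₁) ∧ (d ==ᶜ (proj₁ c₁ ⊓ proj₁ c₂ , proj₂ c₁ ⊓ proj₂ c₂))
  to : T (isDeficitᵇ θ λ′ μ d) → DeficitWitness θ λ′ μ d
  to t with c₁ , c₁∈ , t₁ ← find (any⁻ (λ c₁ → any (witnesses c₁) outside) (cells μ) t)
       with c₂ , c₂∈ , t₂ ← find (any⁻ (witnesses c₁) outside t₁)
       with c₂∈λ , c₂∉μ ← ∈-filter⁻ (T? ∘ (λ c → not (inShapeᵇ μ c))) c₂∈
       with lt , eq ← Equivalence.to T-∧ t₂ = record
    { inner = c₁ ; outer = c₂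
    ; inner∈μ = Equivalence.to (∈-cells⇔ {μ}) c₁∈ ; outer∈λ = Equivalence.to (∈-cells⇔ {λ′}) c₂∈λ
    ; outer∉μ = T-not c₂∉μ ; inverted = <ᵇ⇒< _ _ lt ; at-meet = ==ᶜ⇒≡ d _ eq }
  from : DeficitWitness θ λ′ μ d → T (isDeficitᵇ θ λ′ μ d)
  from w = any⁺ (λ c₁ → any (witnesses c₁) outside)
                (lose (Equivalence.from (∈-cells⇔ {μ}) inner∈μ) (any⁺ (witnesses inner) (lose c₂∈ witnessed)))
    where
    open DeficitWitness w
    c₂∈ : outer ∈ outside
    c₂∈ = ∈-filter⁺ (T? ∘ (λ c → not (inShapeᵇ μ c))) (Equivalence.from (∈-cells⇔ {λ′}) outer∈λ) (¬T-not outer∉μ)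
    witnessed : T (witnesses inner outer)
    witnessed rewrite at-meet = Equivalence.from T-∧ (<⇒<ᵇ inverted , ≡⇒==ᶜ (meet inner outer))

sim-by-rows : ∀ θ λ′ a b → sim θ λ′ (a , b)
  ≡ count a (λ c → not (isDeficitᵇ θ λ′ (a , b) (0 , c))) + count b (λ c → not (isDeficitᵇ θ λ′ (a , b) (1 , c)))
sim-by-rows θ λ′ a b = begin
  length (filterᵇ p (bottom ++ top))                   ≡⟨ cong length (filter-++ (T? ∘ p) bottom top) ⟩
  length (filterᵇ p bottom ++ filterᵇ p top)           ≡⟨ length-++ (filterᵇ p bottom) ⟩
  length (filterᵇ p bottom) + length (filterᵇ p top)   ≡⟨ cong₂ _+_ (row 0 a) (row 1 b) ⟩
  count a (p ∘ (0 ,_)) + count b (p ∘ (1 ,_))          ∎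
  where
  p : Cell → Bool
  p d = not (isDeficitᵇ θ λ′ (a , b) d)
  bottom top : List Cell
  bottom = map (0 ,_) (upTo a)
  top    = map (1 ,_) (upTo b)
  row : ∀ ℓ N → length (filterᵇ p (map (ℓ ,_) (upTo N))) ≡ count N (p ∘ (ℓ ,_))
  row ℓ N = trans (cong (length ∘ filterᵇ p) (map-upTo (ℓ ,_) N)) (length-filterᵇ-applyUpTo p (ℓ ,_) N)


-- Enumerating a filtered range

nth-applyUpTo : ∀ (g : ℕ → ℕ) N k → k < N → nth (applyUpTo g N) k ≡ g k
nth-applyUpTo g (suc N) zero    _   = refl
nth-applyUpTo g (suc N) (suc k) k<N = nth-applyUpTo (g ∘ suc) N k (s≤s⁻¹ k<N)

record Enumeration (Q : ℕ → Bool) (lo : ℕ) (g : ℕ → ℕ) : Set where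
  field
    increasing : ∀ j → g j < g (suc j)
    hits       : ∀ j → Q (g j) ≡ true
    gaps       : ∀ j x → g j < x → x < g (suc j) → Q x ≡ false
    starts     : lo ≤ g 0
    skips      : ∀ x → lo ≤ x → x < g 0 → Q x ≡ false

  monotone : ∀ j → g 0 ≤ g j
  monotone zero    = ≤-refl
  monotone (suc j) = ≤-trans (monotone j) (<⇒≤ (increasing j))

nth-filterᵇ-enumeration : ∀ {Q lo g} → Enumeration Q lo g → ∀ len (f : ℕ → ℕ) j →
  (∀ k → f k ≡ lo + k) → g j < lo + len → nth (filterᵇ Q (applyUpTo f len)) j ≡ g j
nth-filterᵇ-enumeration {lo = lo} e zero f j _ gj<lo+0 =
  ⊥-elim (<⇒≱ gj<lo+0 (≤-trans (≤-reflexive (+-identityʳ lo)) (≤-trans starts (monotone j))))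
  where open Enumeration e
nth-filterᵇ-enumeration {Q} {lo} {g} e (suc len) f j f≡ bound with f 0 | f≡ 0
... | _ | refl rewrite +-identityʳ lo with m≤n⇒m<n∨m≡n (Enumeration.starts e)
...   | inj₁ lo<g0 rewrite Enumeration.skips e lo ≤-refl lo<g0 =
  nth-filterᵇ-enumeration shifted len (f ∘ suc) j (λ k → trans (f≡ (suc k)) (+-suc lo k))
                          (<-≤-trans bound (≤-reflexive (+-suc lo len)))
  where
  open Enumeration e
  shifted : Enumeration Q (suc lo) g
  shifted = record { increasing = increasing ; hits = hits ; gaps = gaps ; starts = lo<g0
                   ; skips = λ x lo<x → skips x (<⇒≤ lo<x) }
...   | inj₂ refl rewrite Enumeration.hits e 0 with j
...     | zero   = refl
...     | suc j′ =
  nth-filterᵇ-enumeration next len (f ∘ suc) j′ (λ k → trans (f≡ (suc k)) (+-suc (g 0) k))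
                          (<-≤-trans bound (≤-reflexive (+-suc (g 0) len)))
  where
  open Enumeration e
  next : Enumeration Q (suc (g 0)) (g ∘ suc)
  next = record { increasing = increasing ∘ suc ; hits = hits ∘ suc ; gaps = gaps ∘ suc ; starts = increasing 0
                ; skips = gaps 0 }


-- The row-regular tableau

module Labels (n P : ℕ) where

  κ : ℕ → ℕ
  κ a = n ⊓ (a ∸ P)

  upperLabel bottomLabel : ℕ → ℕ
  upperLabel k  = suc (P + 2 * k)
  bottomLabel j = suc j + κ (suc j)

  deficitCount : ℕ → ℕ → ℕ
  deficitCount a b = b ⊔ κ a ∸ b ⊓ κ (suc a)

  κ≤n : ∀ a → κ a ≤ n
  κ≤n a = m⊓n≤m n (a ∸ P)

  κ≤∸ : ∀ a → κ a ≤ a ∸ P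
  κ≤∸ a = m⊓n≤n n (a ∸ P)

  κ-mono : ∀ {a a′} → a ≤ a′ → κ a ≤ κ a′
  κ-mono a≤a′ = ⊓-monoʳ-≤ n (∸-monoˡ-≤ P a≤a′)

  κ-step : ∀ a → κ (suc a) ≤ suc (κ a)
  κ-step a = ≤-trans (⊓-monoʳ-≤ n (suc∸≤ a P)) (⊓-monoˡ-≤ (suc (a ∸ P)) (n≤1+n n))
    where
    suc∸≤ : ∀ a P → suc a ∸ P ≤ suc (a ∸ P)
    suc∸≤ a       zero    = ≤-refl
    suc∸≤ zero    (suc P) = ≤-trans (≤-reflexive (0∸n≡0 P)) z≤n
    suc∸≤ (suc a) (suc P) = suc∸≤ a P

  κ<n⇒κ≡∸ : ∀ {a} → κ a < n → κ a ≡ a ∸ P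
  κ<n⇒κ≡∸ {a} κ<n with n ≤? a ∸ P
  ... | yes n≤ = ⊥-elim (<-irrefl (m≤n⇒m⊓n≡m n≤) κ<n)
  ... | no  n≰ = m≥n⇒m⊓n≡n (<⇒≤ (≰⇒> n≰))

  κ-before : ∀ {a} → a ≤ P → κ a ≡ 0
  κ-before a≤P = trans (cong (n ⊓_) (m≤n⇒m∸n≡0 a≤P)) (⊓-zeroʳ n)

  κ-after : ∀ {t} → t ≤ n → κ (P + t) ≡ t
  κ-after {t} t≤n = trans (cong (n ⊓_) (m+n∸m≡n P t)) (m≥n⇒m⊓n≡n t≤n)

  κ1≡0 : n ≤ P → κ 1 ≡ 0
  κ1≡0 = below n P
    where
    below : ∀ n P → n ≤ P → n ⊓ (1 ∸ P) ≡ 0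
    below zero    _       _ = refl
    below (suc n) (suc P) _ = trans (cong (suc n ⊓_) (0∸n≡0 P)) (⊓-zeroʳ (suc n))

  deficit-early : ∀ {a} b → suc a ≤ P → deficitCount a b ≡ b
  deficit-early {a} b sa≤P = begin
    b ⊔ κ a ∸ b ⊓ κ (suc a)  ≡⟨ cong₂ (λ u v → b ⊔ u ∸ b ⊓ v) (κ-before (<⇒≤ sa≤P)) (κ-before sa≤P) ⟩
    b ⊔ 0 ∸ b ⊓ 0            ≡⟨ cong₂ _∸_ (⊔-identityʳ b) (⊓-zeroʳ b) ⟩
    b                        ∎

  κ-after-suc : ∀ {t} → t < n → κ (suc (P + t)) ≡ suc t
  κ-after-suc {t} t<n = trans (cong κ (sym (+-suc P t))) (κ-after t<n)

  deficit-middle< : ∀ {t b} → t < b → b ≤ n → deficitCount (P + t) b ≡ b ∸ suc t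
  deficit-middle< {t} {b} t<b b≤n = begin
    b ⊔ κ (P + t) ∸ b ⊓ κ (suc (P + t))  ≡⟨ cong₂ (λ u v → b ⊔ u ∸ b ⊓ v) (κ-after (<⇒≤ t<n)) (κ-after-suc t<n) ⟩
    b ⊔ t ∸ b ⊓ suc t                    ≡⟨ cong₂ _∸_ (m≥n⇒m⊔n≡m (<⇒≤ t<b)) (m≥n⇒m⊓n≡n t<b) ⟩
    b ∸ suc t                            ∎
    where t<n = <-≤-trans t<b b≤n

  deficit-middle≥ : ∀ {t b} → b ≤ t → t < n → deficitCount (P + t) b ≡ t ∸ b
  deficit-middle≥ {t} {b} b≤t t<n = begin
    b ⊔ κ (P + t) ∸ b ⊓ κ (suc (P + t))  ≡⟨ cong₂ (λ u v → b ⊔ u ∸ b ⊓ v) (κ-after (<⇒≤ t<n)) (κ-after-suc t<n) ⟩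
    b ⊔ t ∸ b ⊓ suc t                    ≡⟨ cong₂ _∸_ (m≤n⇒m⊔n≡n b≤t) (m≤n⇒m⊓n≡m (m≤n⇒m≤1+n b≤t)) ⟩
    t ∸ b                                ∎

  deficit-late : ∀ k {b} → b ≤ n → deficitCount (P + (n + k)) b ≡ n ∸ b
  deficit-late k {b} b≤n = begin
    b ⊔ κ (P + (n + k)) ∸ b ⊓ κ (suc (P + (n + k)))
      ≡⟨ cong₂ (λ u v → b ⊔ u ∸ b ⊓ v) (full (P + (n + k)) ≤-refl) (full (suc (P + (n + k))) (n≤1+n _)) ⟩
    b ⊔ n ∸ b ⊓ n                                    ≡⟨ cong₂ _∸_ (m≤n⇒m⊔n≡n b≤n) (m≤n⇒m⊓n≡m b≤n) ⟩
    n ∸ b                                            ∎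
    where
    full : ∀ a → P + (n + k) ≤ a → κ a ≡ n
    full a le = m≤n⇒m⊓n≡m (m+n≤o⇒m≤o∸n n (≤-trans (≤-reflexive (+-comm n P))
                                         (≤-trans (+-monoʳ-≤ P (m≤m+n n k)) le)))

  upper<bottom : ∀ {j k} → k < κ (suc j) → upperLabel k < bottomLabel j
  upper<bottom {j} {k} k<κ = s≤s (subst (_< j + κ (suc j)) (rearrange P k) k+P+k<)
    where
    k+P+k< : k + P + k < j + κ (suc j)
    k+P+k< = +-mono-≤-< (s≤s⁻¹ (<∸⇒+< k (<-≤-trans k<κ (κ≤∸ (suc j))))) k<κ
    rearrange : ∀ P k → k + P + k ≡ P + 2 * k
    rearrange = solve-∀

  bottom<upper : ∀ {j k} → κ (suc j) ≤ k → k < n → bottomLabel j < upperLabel k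
  bottom<upper {j} {k} κ≤k k<n =
    s≤s (subst (bottomLabel j ≤_) (rearrange P k) (≤-trans g≤ (+-mono-≤ (+-monoʳ-≤ P κ≤k) κ≤k)))
    where
    sj≤ : suc j ≤ P + κ (suc j)
    sj≤ = ≤-trans (m≤n+m∸n (suc j) P) (≤-reflexive (cong (P +_) (sym (κ<n⇒κ≡∸ (≤-<-trans κ≤k k<n)))))
    g≤ : bottomLabel j ≤ P + κ (suc j) + κ (suc j)
    g≤ = +-monoˡ-≤ (κ (suc j)) sj≤
    rearrange : ∀ P k → P + k + k ≡ P + 2 * k
    rearrange = solve-∀

  bottomLabel-mono : ∀ {j₁ j₂} → j₁ < j₂ → bottomLabel j₁ < bottomLabel j₂
  bottomLabel-mono j₁<j₂ = +-mono-<-≤ (s≤s j₁<j₂) (κ-mono (s≤s (<⇒≤ j₁<j₂)))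

  upperLabel-mono : ∀ {k₁ k₂} → k₁ < k₂ → upperLabel k₁ < upperLabel k₂
  upperLabel-mono k₁<k₂ = s≤s (+-monoʳ-< P (*-monoʳ-< 2 k₁<k₂))

  bottomLabel-gap : ∀ {j x} → bottomLabel j < x → x < bottomLabel (suc j) → ∃ λ k → k < n × x ≡ upperLabel k
  bottomLabel-gap {j} {x} lo hi = k , k<n , x≡
    where
    k k′ : ℕ
    k  = κ (suc j)
    k′ = κ (suc (suc j))
    x≤ : x ≤ suc (suc (j + k))
    x≤ = ≤-trans (s≤s⁻¹ hi) (s≤s (≤-trans (+-monoʳ-≤ j (κ-step (suc j))) (≤-reflexive (+-suc j k))))
    x≡ssjk : x ≡ suc (suc (j + k))
    x≡ssjk = ≤-antisym x≤ lo
    k<k′ : k < k′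
    k<k′ = +-cancelˡ-≤ j (suc k) k′ (≤-trans (≤-reflexive (+-suc j k)) (s≤s⁻¹ (≤-trans lo (s≤s⁻¹ hi))))
    k<n : k < n
    k<n = <-≤-trans k<k′ (κ≤n (suc (suc j)))
    P≤sj : P ≤ suc j
    P≤sj = m+n≤o⇒n≤o k (s≤s⁻¹ (<∸⇒+< k (<-≤-trans k<k′ (κ≤∸ (suc (suc j))))))
    sj≡ : suc j ≡ P + k
    sj≡ = trans (sym (m+[n∸m]≡n P≤sj)) (cong (P +_) (sym (κ<n⇒κ≡∸ k<n)))
    x≡ : x ≡ upperLabel k
    x≡ = trans x≡ssjk (cong suc (trans (cong (_+ k) sj≡) (rearrange P k)))
      where
      rearrange : ∀ P k → P + k + k ≡ P + 2 * k
      rearrange = solve-∀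

module RowRegular (m n i′ : ℕ) (fits : n + i′ + n ≤ suc m) where

  P : ℕ
  P = n + i′

  open Labels n P public

  θ : Filling
  θ = rowRegular m n (suc i′)

  label : ℕ → ℕ
  label k = n + suc i′ + 2 * k

  label≡upperLabel : ∀ k → label k ≡ upperLabel k
  label≡upperLabel k = cong (_+ 2 * k) (+-suc n i′)

  isUpperLabel : ℕ → Bool
  isUpperLabel x = any (x ≡ᵇ_) (upperRow n (suc i′))

  isUpperLabel-upperLabel : ∀ {k} → k < n → T (isUpperLabel (upperLabel k))
  isUpperLabel-upperLabel {k} k<n =
    any⁺ (upperLabel k ≡ᵇ_) (lose (∈-map⁺ label (∈-upTo⁺ k<n)) (≡⇒≡ᵇ _ _ (sym (label≡upperLabel k))))

  isUpperLabel⇒ : ∀ {x} → T (isUpperLabel x) → ∃ λ k → k < n × x ≡ upperLabel k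
  isUpperLabel⇒ {x} t with y , y∈ , x≡ᵇy ← find (any⁻ (x ≡ᵇ_) (upperRow n (suc i′)) t)
                       with k , k∈ , refl ← ∈-map⁻ label y∈ =
    k , ∈-upTo⁻ k∈ , trans (≡ᵇ⇒≡ x _ x≡ᵇy) (label≡upperLabel k)

  bottomLabel≢upperLabel : ∀ {j k} → k < n → bottomLabel j ≢ upperLabel k
  bottomLabel≢upperLabel {j} {k} k<n g≡u with k <? κ (suc j)
  ... | yes k<κ = <-irrefl (sym g≡u) (upper<bottom k<κ)
  ... | no  k≮κ = <-irrefl g≡u (bottom<upper (≮⇒≥ k≮κ) k<n)

  bottomLabels : Enumeration (not ∘ isUpperLabel) 1 bottomLabel
  bottomLabels = record
    { increasing = λ j → bottomLabel-mono ≤-refl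
    ; hits       = λ j → Equivalence.to T-≡ (¬T-not (λ t → let k , k<n , g≡u = isUpperLabel⇒ {bottomLabel j} t
                                                       in bottomLabel≢upperLabel k<n g≡u))
    ; gaps       = λ j x lo hi → let k , k<n , x≡u = bottomLabel-gap lo hi in
                     cong not (Equivalence.to T-≡ (subst (T ∘ isUpperLabel) (sym x≡u) (isUpperLabel-upperLabel k<n)))
    ; starts     = s≤s z≤n
    ; skips      = λ x 1≤x x<g0 → ⊥-elim (<⇒≱ x<g0 (≤-trans (s≤s (≤-reflexive (κ1≡0 (m≤m+n n i′)))) 1≤x))
    }

  θ-upper : ∀ {k} → k < n → θ (1 , k) ≡ upperLabel k
  θ-upper {k} k<n = begin
    nth (map label (upTo n)) k    ≡⟨ cong (λ xs → nth xs k) (map-upTo label n) ⟩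
    nth (applyUpTo label n) k     ≡⟨ nth-applyUpTo label n k k<n ⟩
    label k                       ≡⟨ label≡upperLabel k ⟩
    upperLabel k                  ∎

  θ-bottom : ∀ {j} → j < m → θ (0 , j) ≡ bottomLabel j
  θ-bottom {j} j<m = begin
    nth (filterᵇ (not ∘ isUpperLabel) (map suc (upTo (m + n)))) j
      ≡⟨ cong (λ xs → nth (filterᵇ (not ∘ isUpperLabel) xs) j) (map-upTo suc (m + n)) ⟩
    nth (filterᵇ (not ∘ isUpperLabel) (applyUpTo suc (m + n))) j
      ≡⟨ nth-filterᵇ-enumeration bottomLabels (m + n) suc j (λ _ → refl) (s≤s (+-mono-≤ j<m (κ≤n (suc j)))) ⟩
    bottomLabel j
      ∎

  κ-full : κ (suc m) ≡ n
  κ-full = m≤n⇒m⊓n≡m (m+n≤o⇒m≤o∸n n (≤-trans (≤-reflexive (+-comm n P)) fits))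

  isDeficit : ℕ → ℕ → Cell → Bool
  isDeficit a b = isDeficitᵇ θ (m , n) (a , b)

  upper-not-deficit : ∀ {a b c} → ¬ T (isDeficit a b (1 , c))
  upper-not-deficit {a} {b} {c} t with Equivalence.to (isDeficitᵇ⇔ {θ} {m , n} {a , b} {1 , c}) t
  ... | witness (0 , _) _ _ _ _ _ ()
  ... | witness (1 , _) (0 , _) _ _ _ _ ()
  ... | witness (1 , k₁) (1 , k₂) k₁<b k₂<n k₂≮b θk₂<θk₁ _ =
    <-asym (subst₂ _<_ (θ-upper k₂<n') (θ-upper k₁<n) θk₂<θk₁) (upperLabel-mono k₁<k₂)
    where
    k₂<n' = <ᵇ⇒< k₂ n k₂<n
    k₁<k₂ = <-≤-trans (<ᵇ⇒< k₁ b k₁<b) (≮ᵇ⇒≥ {k₂} {b} k₂≮b)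
    k₁<n = <-trans k₁<k₂ k₂<n'
  ... | witness (1 , _) (suc (suc _) , _) _ () _ _ _
  ... | witness (suc (suc _) , _) _ () _ _ _ _

  bottom-deficit⇒ : ∀ {a b c} → a ≤ m → b ≤ a → b ≤ n → T (isDeficit a b (0 , c)) →
    b ⊓ κ (suc a) ≤ c × c < b ⊔ κ a
  bottom-deficit⇒ {a} {b} {c} a≤m b≤a b≤n t with Equivalence.to (isDeficitᵇ⇔ {θ} {m , n} {a , b} {0 , c}) t
  ... | witness (0 , j₁) (0 , j₂) j₁<a j₂<m j₂≮a θj₂<θj₁ _ =
    ⊥-elim (<-asym (subst₂ _<_ (θ-bottom (<ᵇ⇒< j₂ m j₂<m)) (θ-bottom (<-≤-trans j₁<a' a≤m)) θj₂<θj₁)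
                   (bottomLabel-mono (<-≤-trans j₁<a' (≮ᵇ⇒≥ j₂≮a))))
    where j₁<a' = <ᵇ⇒< j₁ a j₁<a
  ... | witness (0 , j₁) (1 , k₂) j₁<a k₂<n k₂≮b θk₂<θj₁ c≡ =
    subst (λ c → b ⊓ κ (suc a) ≤ c × c < b ⊔ κ a) (sym c≡k₂)
      (≤-trans (m⊓n≤m b _) (≮ᵇ⇒≥ k₂≮b) , <-≤-trans k₂<κ (≤-trans (κ-mono j₁<a') (m≤n⊔m b (κ a))))
    where
    j₁<a' = <ᵇ⇒< j₁ a j₁<a
    k₂<n' = <ᵇ⇒< k₂ n k₂<n
    k₂<κ : k₂ < κ (suc j₁)
    k₂<κ with k₂ <? κ (suc j₁)
    ... | yes k₂<κ = k₂<κ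
    ... | no  k₂≮κ = ⊥-elim (<-asym (subst₂ _<_ (θ-upper k₂<n') (θ-bottom (<-≤-trans j₁<a' a≤m)) θk₂<θj₁)
                                    (bottom<upper (≮⇒≥ k₂≮κ) k₂<n'))
    c≡k₂ : c ≡ k₂
    c≡k₂ = trans (cong proj₂ c≡) (m≥n⇒m⊓n≡n (s≤s⁻¹ (<-≤-trans k₂<κ (≤-trans (κ≤∸ (suc j₁)) (m∸n≤m (suc j₁) P)))))
  ... | witness (1 , k₁) (0 , j₂) k₁<b j₂<m j₂≮a θj₂<θk₁ c≡ =
    subst (λ c → b ⊓ κ (suc a) ≤ c × c < b ⊔ κ a) (sym c≡k₁)
      (≤-trans (m⊓n≤n b _) (≤-trans (κ-mono (s≤s a≤j₂)) κ≤k₁) , <-≤-trans k₁<b' (m≤m⊔n b (κ a)))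
    where
    k₁<b' = <ᵇ⇒< k₁ b k₁<b
    a≤j₂ = ≮ᵇ⇒≥ j₂≮a
    j₂<m' = <ᵇ⇒< j₂ m j₂<m
    k₁<n = <-≤-trans k₁<b' b≤n
    κ≤k₁ : κ (suc j₂) ≤ k₁
    κ≤k₁ with k₁ <? κ (suc j₂)
    ... | yes k₁<κ = ⊥-elim (<-asym (subst₂ _<_ (θ-bottom j₂<m') (θ-upper k₁<n) θj₂<θk₁) (upper<bottom k₁<κ))
    ... | no  k₁≮κ = ≮⇒≥ k₁≮κ
    c≡k₁ : c ≡ k₁
    c≡k₁ = trans (cong proj₂ c≡) (m≤n⇒m⊓n≡m (≤-trans (<⇒≤ k₁<b') (≤-trans b≤a a≤j₂)))
  ... | witness (1 , _) (1 , _) _ _ _ _ ()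
  ... | witness (0 , _) (suc (suc _) , _) _ () _ _ _
  ... | witness (1 , _) (suc (suc _) , _) _ () _ _ _
  ... | witness (suc (suc _) , _) _ () _ _ _ _

  bottom-deficit⇐ : ∀ {a b c} → a ≤ m → b ≤ a → b ≤ n → c < a →
    b ⊓ κ (suc a) ≤ c → c < b ⊔ κ a → T (isDeficit a b (0 , c))
  -- The inverted pair (inside μ, outside μ) is (last bottom cell of μ, upper cell c) when b ≤ c,
  -- and (upper cell c, first bottom cell outside μ) when c < b.
  bottom-deficit⇐ {suc a′} {b} {c} a≤m b≤a b≤n c<a lo≤c c<hi with b ≤? c
  ... | yes b≤c = Equivalence.from (isDeficitᵇ⇔ {θ} {m , n} {suc a′ , b} {0 , c})
    (witness (0 , a′) (1 , c) (<⇒<ᵇ (n<1+n a′)) (<⇒<ᵇ c<n) (λ t → <⇒≱ (<ᵇ⇒< c b t) b≤c)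
      (subst₂ _<_ (sym (θ-upper c<n)) (sym (θ-bottom a≤m)) (upper<bottom c<κ))
      (cong (0 ,_) (sym (m≥n⇒m⊓n≡n (s≤s⁻¹ c<a)))))
    where
    c<κ = <⊔⇒< c<hi b≤c
    c<n = <-≤-trans c<κ (κ≤n (suc a′))
  ... | no b≰c = Equivalence.from (isDeficitᵇ⇔ {θ} {m , n} {suc a′ , b} {0 , c})
    (witness (1 , c) (0 , suc a′) (<⇒<ᵇ c<b) (<⇒<ᵇ a<m) (λ t → <-irrefl refl (<ᵇ⇒< (suc a′) (suc a′) t))
      (subst₂ _<_ (sym (θ-bottom a<m)) (sym (θ-upper c<n)) (bottom<upper κ≤c c<n))
      (cong (0 ,_) (sym (m≤n⇒m⊓n≡m (≤-trans (<⇒≤ c<b) b≤a)))))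
    where
    c<b = ≰⇒> b≰c
    c<n = <-≤-trans c<b b≤n
    κ≤c = ⊓≤⇒≤ lo≤c c<b
    a<m : suc a′ < m
    a<m with m≤n⇒m<n∨m≡n a≤m
    ... | inj₁ a<m = a<m
    ... | inj₂ refl = ⊥-elim (<⇒≱ c<n (≤-trans (≤-reflexive (sym κ-full)) κ≤c))

  bottom-deficit≡ : ∀ {a b c} → a ≤ m → b ≤ a → b ≤ n → c < a →
    isDeficit a b (0 , c) ≡ (b ⊓ κ (suc a) ≤ᵇ c) ∧ (c <ᵇ b ⊔ κ a)
  bottom-deficit≡ {a} {b} {c} a≤m b≤a b≤n c<a = T-injective
    (λ t → let lo≤c , c<hi = bottom-deficit⇒ a≤m b≤a b≤n t in Equivalence.from T-∧ (≤⇒≤ᵇ lo≤c , <⇒<ᵇ c<hi))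
    (λ t → let lo≤c , c<hi = Equivalence.to T-∧ t in bottom-deficit⇐ a≤m b≤a b≤n c<a (≤ᵇ⇒≤ _ c lo≤c) (<ᵇ⇒< c _ c<hi))

  b⊔κ≤ : ∀ {a b} → b ≤ a → b ⊔ κ a ≤ a
  b⊔κ≤ {a} b≤a = ⊔-lub b≤a (≤-trans (κ≤∸ a) (m∸n≤m a P))

  deficitCount≤ : ∀ {a b} → b ≤ a → deficitCount a b ≤ a
  deficitCount≤ {a} {b} b≤a = ≤-trans (m∸n≤m (b ⊔ κ a) (b ⊓ κ (suc a))) (b⊔κ≤ b≤a)

  sim-rowRegular : ∀ {a b} → a ≤ m → b ≤ a → b ≤ n → sim θ (m , n) (a , b) ≡ a + b ∸ deficitCount a b
  sim-rowRegular {a} {b} a≤m b≤a b≤n = begin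
    sim θ (m , n) (a , b)
      ≡⟨ sim-by-rows θ (m , n) a b ⟩
    count a (λ c → not (isDeficit a b (0 , c))) + count b (λ c → not (isDeficit a b (1 , c)))
      ≡⟨ cong₂ _+_ (sumTo-cong a (λ c c<a → cong (λ z → if not z then 1 else 0) (bottom-deficit≡ a≤m b≤a b≤n c<a)))
                   (count-all b _ (λ c _ → ¬T-not (upper-not-deficit {a} {b} {c}))) ⟩
    count a (not ∘ deficient) + b
      ≡⟨ cong (_+ b) (count-complement a deficient) ⟩
    a ∸ count a deficient + b
      ≡⟨ cong (λ z → a ∸ z + b) (trans (count-interval lo hi a) (cong (_∸ lo) (m≤n⇒m⊓n≡m (b⊔κ≤ b≤a)))) ⟩
    a ∸ deficitCount a b + b
      ≡⟨ +-∸-comm b (deficitCount≤ b≤a) ⟨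
    a + b ∸ deficitCount a b
      ∎
    where
    lo hi : ℕ
    lo = b ⊓ κ (suc a)
    hi = b ⊔ κ a
    deficient : ℕ → Bool
    deficient c = (lo ≤ᵇ c) ∧ (c <ᵇ hi)


-- Regrouping the subpartitions by deficit

module Regroup (n P m : ℕ) (n≤P : n ≤ P) (fits : P + n ≤ suc m) (e : ℕ → ℕ → ℕ) where

  open Labels n P

  γ : ℕ
  γ = suc m ∸ (P + n)

  E : ℕ → ℕ → ℕ
  E a b = e (a + b) (deficitCount a b)

  -- For fixed b the columns a ≥ b fall into four regimes: a < P, a = P + t with t < b, a = P + t with
  -- b ≤ t < n, and a ≥ P + n, where the deficit is b, b − t − 1, t − b and n − b respectively.
  early middle< middle≥ late : ℕ → ℕ
  early   b = sumTo (P ∸ b) (λ k → e (b + k + b) b)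
  middle< b = sumTo b (λ t → e (P + t + b) (b ∸ suc t))
  middle≥ b = sumTo (n ∸ b) (λ k → e (P + (b + k) + b) k)
  late    b = sumTo γ (λ k → e (P + (n + k) + b) (n ∸ b))

  P+n+γ≡ : P + (n + γ) ≡ suc m
  P+n+γ≡ = trans (sym (+-assoc P n γ)) (m+[n∸m]≡n fits)

  row-by-regime : ∀ {b} → b ≤ n → sumTo (suc m ∸ b) (λ k → E (b + k) b) ≡ early b + middle< b + middle≥ b + late b
  row-by-regime {b} b≤n = begin
    sumTo (suc m ∸ b) (λ k → E (b + k) b)
      ≡⟨ cong (λ z → sumTo z (λ k → E (b + k) b)) (trans (cong (_∸ b) (sym P+n+γ≡)) (+-∸-comm (n + γ) b≤P)) ⟩
    sumTo (P ∸ b + (n + γ)) (λ k → E (b + k) b)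
      ≡⟨ sumTo-split (P ∸ b) (n + γ) (λ k → E (b + k) b) ⟩
    sumTo (P ∸ b) (λ k → E (b + k) b) + sumTo (n + γ) (λ k → E (b + (P ∸ b + k)) b)
      ≡⟨ cong₂ _+_ (sumTo-cong (P ∸ b) early≡) (sumTo-cong (n + γ) (λ k _ → cong (λ a → E a b) (b+[P∸b+k] k))) ⟩
    early b + sumTo (n + γ) (λ t → E (P + t) b)
      ≡⟨ cong (early b +_) (sumTo-split n γ (λ t → E (P + t) b)) ⟩
    early b + (sumTo n (λ t → E (P + t) b) + sumTo γ (λ k → E (P + (n + k)) b))
      ≡⟨ cong (λ z → early b + (z + sumTo γ (λ k → E (P + (n + k)) b))) (sumTo-split-at b (λ t → E (P + t) b) b≤n) ⟩
    early b + (sumTo b (λ t → E (P + t) b) + sumTo (n ∸ b) (λ k → E (P + (b + k)) b) + sumTo γ (λ k → E (P + (n + k)) b))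
      ≡⟨ cong (λ z → early b + z) (cong₂ _+_ (cong₂ _+_ (sumTo-cong b middle<≡) (sumTo-cong (n ∸ b) middle≥≡))
                                              (sumTo-cong γ (λ k _ → cong (e (P + (n + k) + b)) (deficit-late k b≤n)))) ⟩
    early b + (middle< b + middle≥ b + late b)
      ≡⟨ rearrange (early b) (middle< b) (middle≥ b) (late b) ⟩
    early b + middle< b + middle≥ b + late b
      ∎
    where
    b≤P = ≤-trans b≤n n≤P
    b+[P∸b+k] : ∀ k → b + (P ∸ b + k) ≡ P + k
    b+[P∸b+k] k = trans (sym (+-assoc b (P ∸ b) k)) (cong (_+ k) (m+[n∸m]≡n b≤P))
    early≡ : ∀ k → k < P ∸ b → E (b + k) b ≡ e (b + k + b) b
    early≡ k k< = cong (e (b + k + b)) (deficit-early b (subst (_< P) (+-comm k b) (<∸⇒+< k k<)))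
    middle<≡ : ∀ t → t < b → E (P + t) b ≡ e (P + t + b) (b ∸ suc t)
    middle<≡ t t<b = cong (e (P + t + b)) (deficit-middle< t<b b≤n)
    middle≥≡ : ∀ k → k < n ∸ b → E (P + (b + k)) b ≡ e (P + (b + k) + b) k
    middle≥≡ k k< = cong (e (P + (b + k) + b))
      (trans (deficit-middle≥ (m≤m+n b k) (subst (_< n) (+-comm k b) (<∸⇒+< k k<))) (m+n∸m≡n b k))
    rearrange : ∀ w x y z → w + (x + y + z) ≡ w + x + y + z
    rearrange = solve-∀

  middle<-by-deficit : sumTo (suc n) middle< ≡ sumTo (suc n) (λ d → sumTo (n ∸ d) (λ j → e (P + j + suc (d + j)) d))
  middle<-by-deficit = begin
    sumTo (suc n) middle<
      ≡⟨ sumTo-cong (suc n) (λ b _ → trans (sumTo-reverse b (λ t → e (P + t + b) (b ∸ suc t)))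
                                           (sumTo-cong b (λ d d<b → cong (e (P + (b ∸ suc d) + b)) (mirror d<b)))) ⟩
    sumTo (suc n) (λ b → sumTo b (λ d → e (P + (b ∸ suc d) + b) d))
      ≡⟨ sumTo-strict-triangle n (λ b d → e (P + (b ∸ suc d) + b) d) ⟩
    sumTo (suc n) (λ d → sumTo (n ∸ d) (λ j → e (P + (d + j ∸ d) + suc (d + j)) d))
      ≡⟨ sumTo-cong (suc n) (λ d _ → sumTo-cong (n ∸ d) (λ j _ → cong (λ z → e (P + z + suc (d + j)) d) (m+n∸m≡n d j))) ⟩
    sumTo (suc n) (λ d → sumTo (n ∸ d) (λ j → e (P + j + suc (d + j)) d))
      ∎
    where
    mirror : ∀ {d b} → d < b → b ∸ suc (b ∸ suc d) ≡ d
    mirror {d} {b} d<b = trans (cong (b ∸_) (sym (+-∸-assoc 1 d<b))) (m∸[m∸n]≡n (<⇒≤ d<b))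

  middle≥-by-deficit : sumTo (suc n) middle≥ ≡ sumTo (suc n) (λ d → sumTo (n ∸ d) (λ j → e (P + (j + d) + j) d))
  middle≥-by-deficit = sumTo-simplex-swap (suc n) (λ b k → e (P + (b + k) + b) k)

  late-by-deficit : sumTo (suc n) late ≡ sumTo (suc n) (λ d → sumTo γ (λ k → e (P + (n + k) + (n ∸ d)) d))
  late-by-deficit = trans (sumTo-reverse (suc n) late)
    (sumTo-cong (suc n) (λ d d<sn → sumTo-cong γ (λ k _ → cong (e (P + (n + k) + (n ∸ d))) (m∸[m∸n]≡n (s≤s⁻¹ d<sn)))))

  -- The middle block of the merged row interleaves: its even offsets come from middle≥, its odd ones from middle<.
  merge : ∀ d α β {P′ n′} → d + α ≡ P′ → d + β ≡ n′ →
      sumTo α (λ k → e (d + k + d) d)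
    + sumTo β (λ j → e (P′ + j + suc (d + j)) d)
    + sumTo β (λ j → e (P′ + (j + d) + j) d)
    + sumTo γ (λ k → e (P′ + (n′ + k) + β) d)
    ≡ sumTo (α + ((β + β) + γ)) (λ k → e (d + k + d) d)
  merge d α β refl refl = sym (begin
    sumTo (α + ((β + β) + γ)) h
      ≡⟨ sumTo-split α ((β + β) + γ) h ⟩
    sumTo α h + sumTo ((β + β) + γ) (λ k → h (α + k))
      ≡⟨ cong (sumTo α h +_) (sumTo-split (β + β) γ (λ k → h (α + k))) ⟩
    sumTo α h + (sumTo (β + β) (λ k → h (α + k)) + sumTo γ tail)
      ≡⟨ cong (λ z → sumTo α h + (z + sumTo γ tail)) (trans (sumTo-interleave β (λ k → h (α + k))) (sumTo-+ β evens odds)) ⟩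
    sumTo α h + (sumTo β evens + sumTo β odds + sumTo γ tail)
      ≡⟨ reorder (sumTo α h) (sumTo β evens) (sumTo β odds) (sumTo γ tail) ⟩
    sumTo α h + sumTo β odds + sumTo β evens + sumTo γ tail
      ≡⟨ cong₂ _+_ (cong₂ _+_ (cong (sumTo α h +_) (sumTo-cong β (λ j _ → cong (λ s → e s d) (odd≡ d α j))))
                              (sumTo-cong β (λ j _ → cong (λ s → e s d) (even≡ d α j))))
                   (sumTo-cong γ (λ k _ → cong (λ s → e s d) (tail≡ d α β k))) ⟩
    sumTo α h + sumTo β (λ j → e (d + α + j + suc (d + j)) d) + sumTo β (λ j → e (d + α + (j + d) + j) d)
      + sumTo γ (λ k → e (d + α + (d + β + k) + β) d)
      ∎)
    where
    h evens odds tail : ℕ → ℕ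
    h     k = e (d + k + d) d
    evens j = h (α + (j + j))
    odds  j = h (α + suc (j + j))
    tail  k = h (α + (β + β + k))
    reorder : ∀ w x y z → w + (x + y + z) ≡ w + y + x + z
    reorder = solve-∀
    odd≡ : ∀ d α j → d + (α + suc (j + j)) + d ≡ d + α + j + suc (d + j)
    odd≡ = solve-∀
    even≡ : ∀ d α j → d + (α + (j + j)) + d ≡ d + α + (j + d) + j
    even≡ = solve-∀
    tail≡ : ∀ d α β k → d + (α + (β + β + k)) + d ≡ d + α + (d + β + k) + β
    tail≡ = solve-∀

  n≤m : n ≤ m
  n≤m = n+n≤1+m⇒n≤m (≤-trans (+-monoˡ-≤ n n≤P) fits)

  length≡ : ∀ {d} → d ≤ n → P ∸ d + ((n ∸ d + (n ∸ d)) + γ) ≡ suc (m + n ∸ 2 * d) ∸ d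
  length≡ {d} d≤n = sym (begin
    suc (m + n ∸ 2 * d) ∸ d      ≡⟨ cong (_∸ d) (+-∸-assoc 1 2d≤m+n) ⟨
    suc (m + n) ∸ 2 * d ∸ d      ≡⟨ ∸-+-assoc (suc (m + n)) (2 * d) d ⟩
    suc (m + n) ∸ (2 * d + d)    ≡⟨ cong (_∸ (2 * d + d)) total ⟩
    2 * d + d + X ∸ (2 * d + d)  ≡⟨ m+n∸m≡n (2 * d + d) X ⟩
    X                            ∎)
    where
    X : ℕ
    X = P ∸ d + ((n ∸ d + (n ∸ d)) + γ)
    2d≤m+n : 2 * d ≤ m + n
    2d≤m+n = ≤-trans (≤-reflexive (double d)) (+-mono-≤ (≤-trans d≤n n≤m) d≤n)
      where
      double : ∀ d → 2 * d ≡ d + d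
      double = solve-∀
    total : suc m + n ≡ 2 * d + d + X
    total = begin
      suc m + n                                    ≡⟨ cong (_+ n) P+n+γ≡ ⟨
      P + (n + γ) + n                              ≡⟨ cong₂ (λ p q → p + (q + γ) + q) (m+[n∸m]≡n (≤-trans d≤n n≤P)) (m+[n∸m]≡n d≤n) ⟨
      (d + (P ∸ d)) + ((d + (n ∸ d)) + γ) + (d + (n ∸ d))  ≡⟨ collect d (P ∸ d) (n ∸ d) γ ⟩
      2 * d + d + X                                ∎
      where
      collect : ∀ d α β γ → (d + α) + ((d + β) + γ) + (d + β) ≡ 2 * d + d + (α + ((β + β) + γ))
      collect = solve-∀

  regroup-by-deficit : sumTo (suc m) (λ a → sumTo (suc (a ⊓ n)) (λ b → e (a + b) (deficitCount a b)))
    ≡ sumTo (suc n) (λ d → sumTo (suc (m + n ∸ 2 * d) ∸ d) (λ k → e (d + k + d) d))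
  regroup-by-deficit = begin
    sumTo (suc m) (λ a → sumTo (suc (a ⊓ n)) (E a))
      ≡⟨ sumTo-triangle-⊓ E n≤m ⟩
    sumTo (suc n) (λ b → sumTo (suc m ∸ b) (λ k → E (b + k) b))
      ≡⟨ sumTo-cong (suc n) (λ b b<sn → row-by-regime (s≤s⁻¹ b<sn)) ⟩
    sumTo (suc n) (λ b → early b + middle< b + middle≥ b + late b)
      ≡⟨ sumTo-+₄ (suc n) early middle< middle≥ late ⟩
    sumTo (suc n) early + sumTo (suc n) middle< + sumTo (suc n) middle≥ + sumTo (suc n) late
      ≡⟨ cong₂ _+_ (cong₂ _+_ (cong (sumTo (suc n) early +_) middle<-by-deficit) middle≥-by-deficit) late-by-deficit ⟩
    sumTo (suc n) early + sumTo (suc n) odd + sumTo (suc n) even + sumTo (suc n) tail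
      ≡⟨ sumTo-+₄ (suc n) early odd even tail ⟨
    sumTo (suc n) (λ d → early d + odd d + even d + tail d)
      ≡⟨ sumTo-cong (suc n) (λ d d<sn → trans (merge d (P ∸ d) (n ∸ d) (m+[n∸m]≡n (≤-trans (s≤s⁻¹ d<sn) n≤P)) (m+[n∸m]≡n (s≤s⁻¹ d<sn)))
                                               (cong (λ z → sumTo z (λ k → e (d + k + d) d)) (length≡ (s≤s⁻¹ d<sn)))) ⟩
    sumTo (suc n) (λ d → sumTo (suc (m + n ∸ 2 * d) ∸ d) (λ k → e (d + k + d) d))
      ∎
    where
    odd even tail : ℕ → ℕ
    odd  d = sumTo (n ∸ d) (λ j → e (P + j + suc (d + j)) d)
    even d = sumTo (n ∸ d) (λ j → e (P + (j + d) + j) d)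
    tail d = sumTo γ (λ k → e (P + (n + k) + (n ∸ d)) d)

theorem4p10 : (m n : ℕ) → n ≤ m → Triangular (m , n) →
    (i : ℕ) → 1 ≤ i → i + 2 * n ≤ m + 2 →
    (x y : ℕ) →
      Aθ (rowRegular m n i) (m , n) x y
        ≡ ∑ (range 0 (n ⊓ (m ∸ n))) (λ d → schur (m + n ∸ 2 * d) d) x y
theorem4p10 m n _ _ (suc i′) _ i-bound x y = begin
  Aθ θ (m , n) x y
    ≡⟨ Aθ-as-double-sum θ m n x y ⟩
  sumTo (suc m) (λ a → sumTo (suc (a ⊓ n)) (λ b → mono (m + n ∸ (a + b)) (sim θ (m , n) (a , b)) x y))
    ≡⟨ sumTo-cong (suc m) (λ a a≤m → sumTo-cong (suc (a ⊓ n)) (λ b b≤a⊓n → term≡ (s≤s⁻¹ a≤m) (s≤s⁻¹ b≤a⊓n))) ⟩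
  sumTo (suc m) (λ a → sumTo (suc (a ⊓ n)) (λ b → e (a + b) (deficitCount a b)))
    ≡⟨ regroup-by-deficit ⟩
  sumTo (suc n) (λ d → sumTo (suc (m + n ∸ 2 * d) ∸ d) (λ k → e (d + k + d) d))
    ≡⟨ sumTo-cong (suc n) (λ d _ → schur-as-deficit-row (m + n) d x y) ⟩
  sumTo (suc n) S
    ≡⟨ sumTo-pad S (s≤s (m⊓n≤m n (m ∸ n))) S-vanishes ⟨
  sumTo (suc (n ⊓ (m ∸ n))) S
    ≡⟨ ∑-map-upTo (0 +_) (suc (n ⊓ (m ∸ n))) (λ d → schur (m + n ∸ 2 * d) d) x y ⟨
  ∑ (range 0 (n ⊓ (m ∸ n))) (λ d → schur (m + n ∸ 2 * d) d) x y
    ∎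
  where
  fits : n + i′ + n ≤ suc m
  fits = s≤s⁻¹ (subst₂ _≤_ (rearrange i′ n) (+-comm m 2) i-bound)
    where
    rearrange : ∀ i′ n → suc i′ + 2 * n ≡ suc (n + i′ + n)
    rearrange = solve-∀
  2n≤1+m : n + n ≤ suc m
  2n≤1+m = ≤-trans (+-monoˡ-≤ n (m≤m+n n i′)) fits
  open RowRegular m n i′ fits
  e : ℕ → ℕ → ℕ
  e s d = mono (m + n ∸ s) (s ∸ d) x y
  open Regroup n P m (m≤m+n n i′) fits e using (regroup-by-deficit)
  term≡ : ∀ {a b} → a ≤ m → b ≤ a ⊓ n → mono (m + n ∸ (a + b)) (sim θ (m , n) (a , b)) x y ≡ e (a + b) (deficitCount a b)
  term≡ {a} {b} a≤m b≤a⊓n =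
    cong (λ s → mono (m + n ∸ (a + b)) s x y) (sim-rowRegular a≤m (≤-trans b≤a⊓n (m⊓n≤m a n)) (≤-trans b≤a⊓n (m⊓n≤n a n)))
  S : ℕ → ℕ
  S d = schur (m + n ∸ 2 * d) d x y
  S-vanishes : ∀ d → suc (n ⊓ (m ∸ n)) ≤ d → d < suc n → S d ≡ 0
  S-vanishes d cut<d d≤n = schur-vanishes (cutoff<d⇒m+n∸2d<d 2n≤1+m cut<d (s≤s⁻¹ d≤n)) x y
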